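{- Let $q\geq2$ be an integer and $T$ a tensor over $X,Y,Z$ with $|X|=|Y|=|Z|=q$, such that $x_1,x_q\in X$, $y_1,y_q\in Y$, $z_1\in Z$, $T$ contains the terms $x_qy_1z_1$ and $x_1y_qz_1$, and neither $x_q$ nor $y_q$ appears in any other term of $T$. Then there is a constant $c_q<q$ depending only on $q$ such that $\tilde I(T)\leq c_q$.
   Context: A tensor over finite variable sets $X,Y,Z$ (over a field) is a trilinear form $\sum T_{ijk}x_iy_jz_k$; terms are $x_iy_jz_k$ with nonzero coefficient. $T^{\otimes n}$ is the $n$-fold Kronecker tensor power. A zeroing out of $T$ keeps only terms whose variables lie in chosen subsets of $X,Y,Z$. An independent tensor of size $r$ has support of $r$ terms pairwise sharing no variable. $I(T)$ is the largest size of an independent zeroing out of $T$ and $\tilde I(T)=\limsup_nI(T^{\otimes n})^{1/n}$. -}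

module Defs where

open import Data.Nat using (ℕ; zero; suc)
open import Data.Fin using (Fin)
open import Data.Bool using (Bool; true)
open import Data.Product using (Σ; Σ-syntax; _×_; _,_)
open import Relation.Binary.PropositionalEquality using (_≡_; _≢_)
open import Data.Rational using (ℚ; 1ℚ; _*_)
open import Level using (Level; _⊔_) renaming (suc to lsuc)

_^ℚ_ : ℚ → ℕ → ℚ
p ^ℚ zero  = 1ℚ
p ^ℚ suc n = p * (p ^ℚ n)

-- A tensor over variable sets A (the x's), B (the y's), C (the z's),
-- given by its set of terms: Term a b c holds iff x_a y_b z_c has a
-- nonzero coefficient.  (Over a field, all notions in the statement —
-- zeroing out, independence, I, tensor powers — depend only on the terms.)
Tensor : Set → Set → Set → Set₁
Tensor A B C = A → B → C → Set

-- Kronecker tensor power T^{⊗n}: variables are n-tuples of variables;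
-- x_a y_b z_c is a term iff every coordinate is a term of T
-- (coefficients multiply and a field has no zero divisors).
TensorPow : ∀ {A B C} → Tensor A B C → (n : ℕ) →
            Tensor (Fin n → A) (Fin n → B) (Fin n → C)
TensorPow T n a b c = (k : Fin n) → T (a k) (b k) (c k)

record IndepZeroOut {A B C : Set} (T : Tensor A B C) (r : ℕ) : Set₁ where
  field
    X' : A → Bool
    Y' : B → Bool
    Z' : C → Bool
    fx : Fin r → A
    fy : Fin r → B
    fz : Fin r → C
    listed-are-terms : ∀ i → T (fx i) (fy i) (fz i)
    listed-survive   : ∀ i → (X' (fx i) ≡ true) × (Y' (fy i) ≡ true) × (Z' (fz i) ≡ true)
    survivors-listed : ∀ a b c → T a b c → X' a ≡ true → Y' b ≡ true → Z' c ≡ true →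
                       Σ[ i ∈ Fin r ] (fx i ≡ a) × (fy i ≡ b) × (fz i ≡ c)
    independent      : ∀ i j → i ≢ j → (fx i ≢ fx j) × (fy i ≢ fy j) × (fz i ≢ fz j)

-- Give every variable of T a weight so that each term
-- x y z has weight product at least D³, while the weights of X, of Y and of Z
-- each sum to S.  Weights multiply along tensor powers, so every term of an
-- independent zeroing out of T^{⊗n} has a variable of weight at least Dⁿ; as
-- these terms share no variable, r Dⁿ ≤ 3 Sⁿ, whence Ĩ(T) ≤ S / D.  Since x_q
-- and y_q occur only in x_q y_1 z_1 and x_1 y_q z_1, they can be given weight
-- well below D, paid for mainly by z_1, and this pushes S below q D.

module Submission where

open import Defs

module WeightArgument where

  open import Data.Bool using (true; false; if_then_else_)
  open import Data.Fin using (Fin; zero; suc; fromℕ; _≟_)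
  open import Data.Fin.Properties using (suc-injective)
  open import Data.List using (List; []; _∷_; [_]; _++_; map; allFin; cartesianProductWith)
  import Data.List as List
  open import Data.List.Membership.Propositional using (_∈_; _─_)
  open import Data.List.Membership.Propositional.Properties using (∈-allFin; ∈-cartesianProductWith⁺)
  open import Data.List.Properties using (map-++; map-tabulate)
  open import Data.List.Relation.Unary.Any using (here; there)
  open import Data.Nat using (ℕ; zero; suc; _+_; _*_; _^_; _≤_; _<_; z≤n; _≤?_)
  open import Data.Nat.ListAction using (sum)
  open import Data.Nat.ListAction.Properties using (sum-++)
  open import Data.Nat.Properties hiding (suc-injective; _≟_)
  open import Algebra.Properties.CommutativeSemigroup +-commutativeSemigroup
    using () renaming (x∙yz≈y∙xz to m+[n+o]≡n+[m+o])
  open import Algebra.Properties.CommutativeSemigroup *-commutativeSemigroup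
    using () renaming (x∙yz≈y∙xz to m*[n*o]≡n*[m*o])
  open import Algebra.Properties.CommutativeMonoid.Sum +-0-commutativeMonoid using (sum-syntax; ∑-distrib-+)
  open import Data.Nat.Tactic.RingSolver using (solve-∀)
  open import Data.Product using (_×_; _,_; proj₁; proj₂)
  open import Data.Sum using (inj₁; inj₂)
  open import Data.Vec using (Vec; []; _∷_; tabulate; lookup)
  open import Data.Vec.Properties using (lookup∘tabulate)
  open import Function using (_∘_; id; Injective)
  open import Relation.Binary.PropositionalEquality using (_≡_; _≢_; refl; sym; trans; cong; cong₂; subst; _≗_; module ≡-Reasoning)
  open import Relation.Nullary using (yes; no; does; contradiction)
  open import Relation.Nullary.Decidable using (decidable-stable; dec-true; dec-false; toSum)

  ∑-const : ∀ k c → ∑[ i < k ] c ≡ k * c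
  ∑-const zero    c = refl
  ∑-const (suc k) c = cong (c +_) (∑-const k c)

  r*c≤∑ : ∀ {r c} (f : Fin r → ℕ) → (∀ i → c ≤ f i) → r * c ≤ ∑[ i < r ] f i
  r*c≤∑ {zero}  f c≤f = z≤n
  r*c≤∑ {suc r} f c≤f = +-mono-≤ (c≤f zero) (r*c≤∑ (f ∘ suc) (c≤f ∘ suc))

  sum-tabulate : ∀ {k} (f : Fin k → ℕ) → sum (List.tabulate f) ≡ ∑[ i < k ] f i
  sum-tabulate {zero}  f = refl
  sum-tabulate {suc k} f = cong (f zero +_) (sum-tabulate (f ∘ suc))

  sum-map-allFin : ∀ {k} (w : Fin k → ℕ) → sum (map w (allFin k)) ≡ ∑[ i < k ] w i
  sum-map-allFin w = trans (cong sum (map-tabulate id w)) (sum-tabulate w)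

  sum-map-─ : ∀ {A : Set} (w : A → ℕ) {x xs} (x∈xs : x ∈ xs) →
              sum (map w xs) ≡ w x + sum (map w (xs ─ x∈xs))
  sum-map-─ w (here refl) = refl
  sum-map-─ w {x} {y ∷ _} (there x∈xs) =
    trans (cong (w y +_) (sum-map-─ w x∈xs)) (m+[n+o]≡n+[m+o] (w y) (w x) _)

  ∈-─ : ∀ {A : Set} {x y : A} {xs} (x∈xs : x ∈ xs) → y ∈ xs → y ≢ x → y ∈ xs ─ x∈xs
  ∈-─ (here refl)  (here refl)  y≢x = contradiction refl y≢x
  ∈-─ (here refl)  (there y∈xs) _   = y∈xs
  ∈-─ (there _)    (here refl)  _   = here refl
  ∈-─ (there x∈xs) (there y∈xs) y≢x = there (∈-─ x∈xs y∈xs y≢x)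

  ∑-injective≤sum : ∀ {A : Set} {r} (w : A → ℕ) {xs : List A} (g : Fin r → A) →
                    Injective _≡_ _≡_ g → (∀ i → g i ∈ xs) → ∑[ i < r ] w (g i) ≤ sum (map w xs)
  ∑-injective≤sum {r = zero}  w g _ _ = z≤n
  ∑-injective≤sum {r = suc r} w {xs} g g-inj g∈xs = begin
    w (g zero) + ∑[ i < r ] w (g (suc i))      ≤⟨ +-monoʳ-≤ (w (g zero)) (∑-injective≤sum w (g ∘ suc) tail-inj tail∈) ⟩
    w (g zero) + sum (map w (xs ─ g∈xs zero))  ≡⟨ sum-map-─ w (g∈xs zero) ⟨
    sum (map w xs)                             ∎
    where
    open ≤-Reasoning
    tail-inj : Injective _≡_ _≡_ (g ∘ suc)
    tail-inj eq = suc-injective (g-inj eq)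
    tail∈ : ∀ i → g (suc i) ∈ xs ─ g∈xs zero
    tail∈ i = ∈-─ (g∈xs zero) (g∈xs (suc i)) (λ eq → contradiction (g-inj eq) λ ())

  tupleWeight : ∀ {A : Set} {n} → (A → ℕ) → Vec A n → ℕ
  tupleWeight w []      = 1
  tupleWeight w (x ∷ v) = w x * tupleWeight w v

  tuples : ∀ {A : Set} → List A → (n : ℕ) → List (Vec A n)
  tuples xs zero    = [ [] ]
  tuples xs (suc n) = cartesianProductWith _∷_ xs (tuples xs n)

  ∈-tuples : ∀ {A : Set} {xs : List A} → (∀ x → x ∈ xs) → ∀ {n} (v : Vec A n) → v ∈ tuples xs n
  ∈-tuples x∈xs []      = here refl
  ∈-tuples x∈xs (x ∷ v) = ∈-cartesianProductWith⁺ _∷_ (x∈xs x) (∈-tuples x∈xs v)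

  module _ {A : Set} (w : A → ℕ) where

    sum-map-tupleWeight-∷ : ∀ {n} x (vs : List (Vec A n)) →
      sum (map (tupleWeight w) (map (x ∷_) vs)) ≡ w x * sum (map (tupleWeight w) vs)
    sum-map-tupleWeight-∷ x []       = sym (*-zeroʳ (w x))
    sum-map-tupleWeight-∷ x (v ∷ vs) =
      trans (cong (w x * tupleWeight w v +_) (sum-map-tupleWeight-∷ x vs))
            (sym (*-distribˡ-+ (w x) _ _))

    sum-map-tupleWeight-cartesian : ∀ {n} xs (vs : List (Vec A n)) →
      sum (map (tupleWeight w) (cartesianProductWith _∷_ xs vs)) ≡ sum (map w xs) * sum (map (tupleWeight w) vs)
    sum-map-tupleWeight-cartesian []       vs = refl
    sum-map-tupleWeight-cartesian {n} (x ∷ xs) vs = begin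
      sum (map W (map (x ∷_) vs ++ rest))         ≡⟨ cong sum (map-++ W (map (x ∷_) vs) rest) ⟩
      sum (map W (map (x ∷_) vs) ++ map W rest)   ≡⟨ sum-++ (map W (map (x ∷_) vs)) (map W rest) ⟩
      sum (map W (map (x ∷_) vs)) + sum (map W rest)
        ≡⟨ cong₂ _+_ (sum-map-tupleWeight-∷ x vs) (sum-map-tupleWeight-cartesian xs vs) ⟩
      w x * sum (map W vs) + sum (map w xs) * sum (map W vs)
        ≡⟨ *-distribʳ-+ (sum (map W vs)) (w x) (sum (map w xs)) ⟨
      (w x + sum (map w xs)) * sum (map W vs)     ∎
      where
      open ≡-Reasoning
      W : ∀ {n} → Vec A n → ℕ
      W = tupleWeight w
      rest : List (Vec A (suc n))
      rest = cartesianProductWith _∷_ xs vs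

    sum-map-tupleWeight-tuples : ∀ xs n → sum (map (tupleWeight w) (tuples xs n)) ≡ sum (map w xs) ^ n
    sum-map-tupleWeight-tuples xs zero    = refl
    sum-map-tupleWeight-tuples xs (suc n) =
      trans (sum-map-tupleWeight-cartesian xs (tuples xs n))
            (cong (sum (map w xs) *_) (sum-map-tupleWeight-tuples xs n))

  ∑-tupleWeight-injective≤ : ∀ {k n r} (w : Fin k → ℕ) (g : Fin r → Vec (Fin k) n) → Injective _≡_ _≡_ g →
                             ∑[ i < r ] tupleWeight w (g i) ≤ (∑[ x < k ] w x) ^ n
  ∑-tupleWeight-injective≤ {k} {n} {r} w g g-inj = begin
    ∑[ i < r ] tupleWeight w (g i)             ≤⟨ ∑-injective≤sum (tupleWeight w) g g-inj (∈-tuples ∈-allFin ∘ g) ⟩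
    sum (map (tupleWeight w) (tuples (allFin k) n)) ≡⟨ sum-map-tupleWeight-tuples w (allFin k) n ⟩
    sum (map w (allFin k)) ^ n                 ≡⟨ cong (_^ n) (sum-map-allFin w) ⟩
    (∑[ x < k ] w x) ^ n                       ∎
    where open ≤-Reasoning

  -- Variables of T^{⊗n} are functions Fin n → _; they are compared through
  -- `tabulate` because equality of functions is not extensional.
  tabulate-injective : ∀ {A : Set} {n} {f g : Fin n → A} → tabulate f ≡ tabulate g → f ≗ g
  tabulate-injective {f = f} {g} eq k =
    trans (sym (lookup∘tabulate f k)) (trans (cong (λ v → lookup v k) eq) (lookup∘tabulate g k))

  separated⇒injective : ∀ {A : Set} {r} (f : Fin r → A) → (∀ i j → i ≢ j → f i ≢ f j) → Injective _≡_ _≡_ f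
  separated⇒injective f sep {i} {j} fi≡fj = decidable-stable (i ≟ j) (λ i≢j → sep i j i≢j fi≡fj)

  module _ {A B C : Set} {T : Tensor A B C} {r : ℕ} (Z : IndepZeroOut T r) where

    private
      module Z = IndepZeroOut Z

    listed-term-indices : ∀ {i j k} → T (Z.fx i) (Z.fy j) (Z.fz k) → i ≡ j × i ≡ k
    listed-term-indices {i} {j} {k} t
      with l , x≡ , y≡ , z≡ ← Z.survivors-listed _ _ _ t
             (proj₁ (Z.listed-survive i)) (proj₁ (proj₂ (Z.listed-survive j))) (proj₂ (proj₂ (Z.listed-survive k)))
      = trans (sym (fx-injective x≡)) (fy-injective y≡) , trans (sym (fx-injective x≡)) (fz-injective z≡)
      where
      fx-injective : Injective _≡_ _≡_ Z.fx
      fx-injective = separated⇒injective Z.fx (λ i j i≢j → proj₁ (Z.independent i j i≢j))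
      fy-injective : Injective _≡_ _≡_ Z.fy
      fy-injective = separated⇒injective Z.fy (λ i j i≢j → proj₁ (proj₂ (Z.independent i j i≢j)))
      fz-injective : Injective _≡_ _≡_ Z.fz
      fz-injective = separated⇒injective Z.fz (λ i j i≢j → proj₂ (proj₂ (Z.independent i j i≢j)))

  module _ {A B C : Set} {T : Tensor A B C} {n r : ℕ} (Z : IndepZeroOut (TensorPow T n) r) where

    private
      module Z = IndepZeroOut Z

    x-tuples-injective : Injective _≡_ _≡_ (λ i → tabulate (Z.fx i))
    x-tuples-injective {i} {j} eq = sym (proj₁ (listed-term-indices Z term))
      where
      term : TensorPow T n (Z.fx j) (Z.fy i) (Z.fz i)
      term k = subst (λ u → T u (Z.fy i k) (Z.fz i k)) (tabulate-injective eq k) (Z.listed-are-terms i k)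

    y-tuples-injective : Injective _≡_ _≡_ (λ i → tabulate (Z.fy i))
    y-tuples-injective {i} {j} eq = proj₁ (listed-term-indices Z term)
      where
      term : TensorPow T n (Z.fx i) (Z.fy j) (Z.fz i)
      term k = subst (λ u → T (Z.fx i k) u (Z.fz i k)) (tabulate-injective eq k) (Z.listed-are-terms i k)

    z-tuples-injective : Injective _≡_ _≡_ (λ i → tabulate (Z.fz i))
    z-tuples-injective {i} {j} eq = proj₂ (listed-term-indices Z term)
      where
      term : TensorPow T n (Z.fx i) (Z.fy i) (Z.fz j)
      term k = subst (λ u → T (Z.fx i k) (Z.fy i k) u) (tabulate-injective eq k) (Z.listed-are-terms i k)

  cube≤product⇒≤sum : ∀ x f g h → x * x * x ≤ f * g * h → x ≤ f + g + h
  cube≤product⇒≤sum x f g h x³≤fgh with x ≤? f | x ≤? g | x ≤? h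
  ... | yes x≤f | _       | _       = ≤-trans x≤f (≤-trans (m≤m+n f g) (m≤m+n (f + g) h))
  ... | no _    | yes x≤g | _       = ≤-trans x≤g (≤-trans (m≤n+m g f) (m≤m+n (f + g) h))
  ... | no _    | no _    | yes x≤h = ≤-trans x≤h (m≤n+m h (f + g))
  ... | no x≰f  | no x≰g  | no x≰h  =
    contradiction x³≤fgh (<⇒≱ (*-mono-< (*-mono-< (≰⇒> x≰f) (≰⇒> x≰g)) (≰⇒> x≰h)))

  *-interchange₃ : ∀ a b c x y z → (a * x) * (b * y) * (c * z) ≡ (a * b * c) * (x * y * z)
  *-interchange₃ = solve-∀

  module _ {a b c : ℕ} (T : Tensor (Fin a) (Fin b) (Fin c))
           (wx : Fin a → ℕ) (wy : Fin b → ℕ) (wz : Fin c → ℕ) (d : ℕ)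
           (d³≤weight : ∀ {x y z} → T x y z → d * d * d ≤ wx x * wy y * wz z) where

    d³≤tupleWeight : ∀ {n xs ys zs} → TensorPow T n xs ys zs →
      d ^ n * d ^ n * d ^ n ≤ tupleWeight wx (tabulate xs) * tupleWeight wy (tabulate ys) * tupleWeight wz (tabulate zs)
    d³≤tupleWeight {zero}  t = ≤-refl
    d³≤tupleWeight {suc n} {xs} {ys} {zs} t = begin
      (d * d ^ n) * (d * d ^ n) * (d * d ^ n)   ≡⟨ *-interchange₃ d d d (d ^ n) (d ^ n) (d ^ n) ⟩
      (d * d * d) * (d ^ n * d ^ n * d ^ n)     ≤⟨ *-mono-≤ (d³≤weight (t zero)) (d³≤tupleWeight (t ∘ suc)) ⟩
      (wx (xs zero) * wy (ys zero) * wz (zs zero)) * (Wx * Wy * Wz)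
        ≡⟨ *-interchange₃ (wx (xs zero)) (wy (ys zero)) (wz (zs zero)) Wx Wy Wz ⟨
      (wx (xs zero) * Wx) * (wy (ys zero) * Wy) * (wz (zs zero) * Wz) ∎
      where
      open ≤-Reasoning
      Wx = tupleWeight wx (tabulate (xs ∘ suc))
      Wy = tupleWeight wy (tabulate (ys ∘ suc))
      Wz = tupleWeight wz (tabulate (zs ∘ suc))

    independent-size-bound : ∀ {n r} → IndepZeroOut (TensorPow T n) r →
      r * d ^ n ≤ (∑[ x < a ] wx x) ^ n + (∑[ y < b ] wy y) ^ n + (∑[ z < c ] wz z) ^ n
    independent-size-bound {n} {r} Z = begin
      r * d ^ n                                   ≤⟨ r*c≤∑ (λ i → Wx i + Wy i + Wz i) d^n≤ ⟩
      ∑[ i < r ] (Wx i + Wy i + Wz i)             ≡⟨ ∑-distrib-+ (λ i → Wx i + Wy i) Wz ⟩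
      ∑[ i < r ] (Wx i + Wy i) + ∑[ i < r ] Wz i  ≡⟨ cong (_+ ∑[ i < r ] Wz i) (∑-distrib-+ Wx Wy) ⟩
      ∑[ i < r ] Wx i + ∑[ i < r ] Wy i + ∑[ i < r ] Wz i
        ≤⟨ +-mono-≤ (+-mono-≤ (∑-tupleWeight-injective≤ wx _ (x-tuples-injective {T = T} Z))
                               (∑-tupleWeight-injective≤ wy _ (y-tuples-injective {T = T} Z)))
                    (∑-tupleWeight-injective≤ wz _ (z-tuples-injective {T = T} Z)) ⟩
      (∑[ x < a ] wx x) ^ n + (∑[ y < b ] wy y) ^ n + (∑[ z < c ] wz z) ^ n ∎
      where
      open ≤-Reasoning
      module Z = IndepZeroOut Z
      Wx Wy Wz : Fin r → ℕ
      Wx i = tupleWeight wx (tabulate (Z.fx i))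
      Wy i = tupleWeight wy (tabulate (Z.fy i))
      Wz i = tupleWeight wz (tabulate (Z.fz i))
      d^n≤ : ∀ i → d ^ n ≤ Wx i + Wy i + Wz i
      d^n≤ i = cube≤product⇒≤sum (d ^ n) (Wx i) (Wy i) (Wz i) (d³≤tupleWeight (Z.listed-are-terms i))

  pointWeight : ∀ {k} → Fin k → ℕ → ℕ → Fin k → ℕ
  pointWeight e a b i = if does (i ≟ e) then a else b

  pointWeight-≡ : ∀ {k} (e : Fin k) {a b} → pointWeight e a b e ≡ a
  pointWeight-≡ e {a} {b} = cong (if_then a else b) (dec-true (e ≟ e) refl)

  pointWeight-≢ : ∀ {k} {e i : Fin k} {a b} → i ≢ e → pointWeight e a b i ≡ b
  pointWeight-≢ {e = e} {i} {a} {b} i≢e = cong (if_then a else b) (dec-false (i ≟ e) i≢e)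

  b≤pointWeight : ∀ {k} (e i : Fin k) {a b} → b ≤ a → b ≤ pointWeight e a b i
  b≤pointWeight e i {a} {b} b≤a = b≤if (does (i ≟ e))
    where
    b≤if : ∀ t → b ≤ (if t then a else b)
    b≤if true  = b≤a
    b≤if false = ≤-refl

  ∑-pointWeight : ∀ {k} (e : Fin (suc k)) a b → ∑[ i < suc k ] pointWeight e a b i ≡ a + k * b
  ∑-pointWeight {k}     zero    a b = cong (a +_) (∑-const k b)
  ∑-pointWeight {suc k} (suc e) a b =
    trans (cong (b +_) (∑-pointWeight e a b)) (m+[n+o]≡n+[m+o] b a (k * b))

  module CornerWeights (m : ℕ) where

    -- With q = m + 2: D = 10q, x_q and y_q weigh 8q + 1, the other x's and y's
    -- 10q + 2, z_1 weighs 13q − 4 and the other z's 10q − 3.  Each of the three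
    -- totals is S = 10q² − 1 = qD − 1.
    q D α β γ δ S : ℕ
    q = suc (suc m)
    D = 10 * q
    α = 8 * m + 17
    β = 10 * m + 22
    γ = 13 * m + 22
    δ = 10 * m + 17
    S = 10 * m * m + 40 * m + 39

    last : Fin q
    last = fromℕ (suc m)

    wx wz : Fin q → ℕ
    wx = pointWeight last α β
    wz = pointWeight zero γ δ

    ∑-wx : ∑[ i < q ] wx i ≡ S
    ∑-wx = trans (∑-pointWeight last α β) (total m)
      where
      total : ∀ m → 8 * m + 17 + suc m * (10 * m + 22) ≡ 10 * m * m + 40 * m + 39
      total = solve-∀

    ∑-wz : ∑[ i < q ] wz i ≡ S
    ∑-wz = trans (∑-pointWeight {suc m} zero γ δ) (total m)
      where
      total : ∀ m → 13 * m + 22 + suc m * (10 * m + 17) ≡ 10 * m * m + 40 * m + 39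
      total = solve-∀

    2S+1<2qD : suc (2 * S) * 1 < q * (2 * D)
    2S+1<2qD = ≤-reflexive (expand m)
      where
      expand : ∀ m → suc (suc (2 * (10 * m * m + 40 * m + 39)) * 1) ≡ suc (suc m) * (2 * (10 * suc (suc m)))
      expand = solve-∀

    D³≤αβγ : D * D * D ≤ α * β * γ
    D³≤αβγ = subst (D * D * D ≤_) (sym (expand m)) (m≤m+n (D * D * D) _)
      where
      expand : ∀ m → (8 * m + 17) * (10 * m + 22) * (13 * m + 22)
                   ≡ 10 * suc (suc m) * (10 * suc (suc m)) * (10 * suc (suc m))
                     + (40 * m * m * m + 258 * m * m + 474 * m + 228)
      expand = solve-∀

    D³≤ββδ : D * D * D ≤ β * β * δ
    D³≤ββδ = subst (D * D * D ≤_) (sym (expand m)) (m≤m+n (D * D * D) _)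
      where
      expand : ∀ m → (10 * m + 22) * (10 * m + 22) * (10 * m + 17)
                   ≡ 10 * suc (suc m) * (10 * suc (suc m)) * (10 * suc (suc m))
                     + (100 * m * m + 320 * m + 228)
      expand = solve-∀

    δ≤γ : δ ≤ γ
    δ≤γ = +-mono-≤ (*-monoˡ-≤ m (m≤m+n 10 3)) (m≤m+n 17 5)

    module _ (T : Tensor (Fin q) (Fin q) (Fin q))
             (x-last-isolated : ∀ j k → T last j k → (j ≡ zero) × (k ≡ zero))
             (y-last-isolated : ∀ i k → T i last k → (i ≡ zero) × (k ≡ zero)) where

      D³≤cornerWeight : ∀ {x y z} → T x y z → D * D * D ≤ wx x * wx y * wz z
      -- Splitting on `x ≟ last` directly would also abstract it inside `wx x`.
      D³≤cornerWeight {x} {y} {z} t with toSum (x ≟ last) | toSum (y ≟ last)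
      ... | inj₁ refl | _ with refl , refl ← x-last-isolated y z t = begin
        D * D * D  ≤⟨ D³≤αβγ ⟩
        α * β * γ  ≡⟨ cong (λ w → w * β * γ) (pointWeight-≡ last) ⟨
        wx last * wx zero * wz zero ∎
        where open ≤-Reasoning
      ... | inj₂ _ | inj₁ refl with refl , refl ← y-last-isolated x z t = begin
        D * D * D  ≤⟨ D³≤αβγ ⟩
        α * β * γ  ≡⟨ cong (_* γ) (*-comm α β) ⟩
        β * α * γ  ≡⟨ cong (λ w → β * w * γ) (pointWeight-≡ last) ⟨
        wx zero * wx last * wz zero ∎
        where open ≤-Reasoning
      ... | inj₂ x≢last | inj₂ y≢last = begin
        D * D * D        ≤⟨ D³≤ββδ ⟩
        β * β * δ        ≤⟨ *-monoʳ-≤ (β * β) (b≤pointWeight zero z δ≤γ) ⟩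
        β * β * wz z     ≡⟨ cong₂ (λ u v → u * v * wz z) (pointWeight-≢ x≢last) (pointWeight-≢ y≢last) ⟨
        wx x * wx y * wz z ∎
        where open ≤-Reasoning

      corner-independent-bound : ∀ {n r} → IndepZeroOut (TensorPow T n) r → r * D ^ n ≤ S ^ n + S ^ n + S ^ n
      corner-independent-bound {n} {r} Z =
        subst (r * D ^ n ≤_) (cong₂ (λ s t → s ^ n + s ^ n + t ^ n) ∑-wx ∑-wz)
              (independent-size-bound T wx wx wz D D³≤cornerWeight Z)

  ^-distribʳ-* : ∀ a b n → (a * b) ^ n ≡ a ^ n * b ^ n
  ^-distribʳ-* a b zero    = refl
  ^-distribʳ-* a b (suc n) =
    trans (cong (a * b *_) (^-distribʳ-* a b n)) ([m*n]*[o*p]≡[m*o]*[n*p] a b (a ^ n) (b ^ n))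

  bernoulli : ∀ k n → k ^ n * (k + n) ≤ k * suc k ^ n
  bernoulli k zero    = ≤-reflexive (base k)
    where
    base : ∀ k → 1 * (k + 0) ≡ k * 1
    base = solve-∀
  bernoulli k (suc n) = begin
    k * k ^ n * (k + suc n)             ≤⟨ m≤m+n _ (k ^ n * n) ⟩
    k * k ^ n * (k + suc n) + k ^ n * n ≡⟨ expand k (k ^ n) n ⟨
    k ^ n * (k + n) * suc k             ≤⟨ *-monoˡ-≤ (suc k) (bernoulli k n) ⟩
    k * suc k ^ n * suc k               ≡⟨ rotate k (suc k ^ n) ⟩
    k * (suc k * suc k ^ n)             ∎
    where
    open ≤-Reasoning
    expand : ∀ k x n → x * (k + n) * suc k ≡ k * x * (k + suc n) + x * n
    expand = solve-∀
    rotate : ∀ k x → k * x * suc k ≡ k * (suc k * x)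
    rotate = solve-∀

  three*^≤suc^ : ∀ k n → 2 * k < n → 3 * k ^ n ≤ suc k ^ n
  three*^≤suc^ zero    zero    ()
  three*^≤suc^ zero    (suc n) _    = z≤n
  three*^≤suc^ (suc k) n       2k<n = *-cancelˡ-≤ (suc k) (begin
    suc k * (3 * suc k ^ n)        ≡⟨ rearrange (suc k) (suc k ^ n) ⟩
    suc k ^ n * (suc k + 2 * suc k) ≤⟨ *-monoʳ-≤ (suc k ^ n) (+-monoʳ-≤ (suc k) (<⇒≤ 2k<n)) ⟩
    suc k ^ n * (suc k + n)        ≤⟨ bernoulli (suc k) n ⟩
    suc k * suc (suc k) ^ n        ∎)
    where
    open ≤-Reasoning
    rearrange : ∀ k x → k * (3 * x) ≡ x * (k + 2 * k)
    rearrange = solve-∀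

  absorb-three : ∀ {r d s n} → r * d ^ n ≤ s ^ n + s ^ n + s ^ n → 2 * (2 * s) < n →
                 r * (2 * d) ^ n ≤ suc (2 * s) ^ n
  absorb-three {r} {d} {s} {n} r*dⁿ≤3sⁿ 4s<n = begin
    r * (2 * d) ^ n                 ≡⟨ cong (r *_) (^-distribʳ-* 2 d n) ⟩
    r * (2 ^ n * d ^ n)             ≡⟨ m*[n*o]≡n*[m*o] r (2 ^ n) (d ^ n) ⟩
    2 ^ n * (r * d ^ n)             ≤⟨ *-monoʳ-≤ (2 ^ n) r*dⁿ≤3sⁿ ⟩
    2 ^ n * (s ^ n + s ^ n + s ^ n) ≡⟨ gather (2 ^ n) (s ^ n) ⟩
    3 * (2 ^ n * s ^ n)             ≡⟨ cong (3 *_) (^-distribʳ-* 2 s n) ⟨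
    3 * (2 * s) ^ n                 ≤⟨ three*^≤suc^ (2 * s) n 4s<n ⟩
    suc (2 * s) ^ n                 ∎
    where
    open ≤-Reasoning
    gather : ∀ a x → a * (x + x + x) ≡ 3 * (a * x)
    gather = solve-∀

open WeightArgument using (module CornerWeights; absorb-three)

open import Data.Nat as ℕ using (ℕ; zero; suc; _≥_)
open import Data.Fin using (Fin; fromℕ) renaming (zero to fz)
open import Data.Product using (Σ; Σ-syntax; _×_; _,_)
open import Relation.Binary.PropositionalEquality using (_≡_; refl; sym; trans; cong; subst; subst₂; module ≡-Reasoning)
open import Data.Rational using (ℚ; _<_; _≤_; _+_; _/_; 0ℚ; 1ℚ; _*_; toℚᵘ; nonNegative)
open import Data.Integer as ℤ using (+_; +≤+; +<+)
import Data.Integer.Properties as ℤ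
import Data.Rational.Properties as ℚ
open import Data.Rational.Unnormalised as ℚᵘ using (ℚᵘ; mkℚᵘ; ↥_; ↧ₙ_; *≤*; *<*)
import Data.Rational.Unnormalised.Properties as ℚᵘ

-- Passing to ℚ, where comparisons reduce to cross-multiplication in ℚᵘ

_^ᵘ_ : ℚᵘ → ℕ → ℚᵘ
p ^ᵘ zero  = ℚᵘ.1ℚᵘ
p ^ᵘ suc n = p ℚᵘ.* (p ^ᵘ n)

toℚᵘ-homo-^ : ∀ p n → toℚᵘ (p ^ℚ n) ℚᵘ.≃ toℚᵘ p ^ᵘ n
toℚᵘ-homo-^ p zero    = ℚᵘ.≃-refl
toℚᵘ-homo-^ p (suc n) = ℚᵘ.≃-trans (ℚ.toℚᵘ-homo-* p (p ^ℚ n)) (ℚᵘ.*-congˡ {toℚᵘ p} (toℚᵘ-homo-^ p n))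

^ᵘ-congˡ : ∀ {p q} n → p ℚᵘ.≃ q → p ^ᵘ n ℚᵘ.≃ q ^ᵘ n
^ᵘ-congˡ zero    p≃q = ℚᵘ.≃-refl
^ᵘ-congˡ (suc n) p≃q = ℚᵘ.*-cong p≃q (^ᵘ-congˡ n p≃q)

↥-* : ∀ p q → ↥ (p ℚᵘ.* q) ≡ ↥ p ℤ.* ↥ q
↥-* (mkℚᵘ _ _) (mkℚᵘ _ _) = refl

↧ₙ-* : ∀ p q → ↧ₙ (p ℚᵘ.* q) ≡ ↧ₙ p ℕ.* ↧ₙ q
↧ₙ-* (mkℚᵘ _ _) (mkℚᵘ _ _) = refl

↥-^ᵘ : ∀ a k n → ↥ (mkℚᵘ (+ a) k ^ᵘ n) ≡ + (a ℕ.^ n)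
↥-^ᵘ a k zero    = refl
↥-^ᵘ a k (suc n) = begin
  ↥ (mkℚᵘ (+ a) k ^ᵘ suc n)    ≡⟨ ↥-* (mkℚᵘ (+ a) k) (mkℚᵘ (+ a) k ^ᵘ n) ⟩
  + a ℤ.* ↥ (mkℚᵘ (+ a) k ^ᵘ n) ≡⟨ cong (+ a ℤ.*_) (↥-^ᵘ a k n) ⟩
  + a ℤ.* + (a ℕ.^ n)           ≡⟨ ℤ.pos-* a (a ℕ.^ n) ⟨
  + (a ℕ.^ suc n)               ∎
  where open ≡-Reasoning

↧ₙ-^ᵘ : ∀ a k n → ↧ₙ (mkℚᵘ (+ a) k ^ᵘ n) ≡ suc k ℕ.^ n
↧ₙ-^ᵘ a k zero    = refl
↧ₙ-^ᵘ a k (suc n) = trans (↧ₙ-* (mkℚᵘ (+ a) k) (mkℚᵘ (+ a) k ^ᵘ n)) (cong (suc k ℕ.*_) (↧ₙ-^ᵘ a k n))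

fraction<fraction : ∀ a k b l → a ℕ.* suc l ℕ.< b ℕ.* suc k → (+ a) / suc k < (+ b) / suc l
fraction<fraction a k b l al<bk = ℚ.toℚᵘ-cancel-<
  (ℚᵘ.<-respˡ-≃ (ℚᵘ.≃-sym (ℚ.toℚᵘ-fromℚᵘ (mkℚᵘ (+ a) k)))
  (ℚᵘ.<-respʳ-≃ (ℚᵘ.≃-sym (ℚ.toℚᵘ-fromℚᵘ (mkℚᵘ (+ b) l))) (*<* cross)))
  where
  cross : + a ℤ.* + suc l ℤ.< + b ℤ.* + suc k
  cross = subst₂ ℤ._<_ (ℤ.pos-* a (suc l)) (ℤ.pos-* b (suc k)) (+<+ al<bk)

fromℕ≤fraction^ : ∀ r a k n → r ℕ.* suc k ℕ.^ n ℕ.≤ a ℕ.^ n → (+ r) / 1 ≤ ((+ a) / suc k) ^ℚ n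
fromℕ≤fraction^ r a k n rkⁿ≤aⁿ = ℚ.toℚᵘ-cancel-≤
  (ℚᵘ.≤-respˡ-≃ (ℚᵘ.≃-sym (ℚ.toℚᵘ-fromℚᵘ (mkℚᵘ (+ r) 0)))
  (ℚᵘ.≤-respʳ-≃ (ℚᵘ.≃-sym cⁿ≃P) (*≤* cross)))
  where
  P : ℚᵘ
  P = mkℚᵘ (+ a) k ^ᵘ n
  cⁿ≃P : toℚᵘ (((+ a) / suc k) ^ℚ n) ℚᵘ.≃ P
  cⁿ≃P = ℚᵘ.≃-trans (toℚᵘ-homo-^ ((+ a) / suc k) n) (^ᵘ-congˡ n (ℚ.toℚᵘ-fromℚᵘ (mkℚᵘ (+ a) k)))
  cross : + r ℤ.* + ↧ₙ P ℤ.≤ ↥ P ℤ.* + 1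
  cross = begin
    + r ℤ.* + ↧ₙ P           ≡⟨ cong (λ d → + r ℤ.* + d) (↧ₙ-^ᵘ a k n) ⟩
    + r ℤ.* + (suc k ℕ.^ n)  ≡⟨ ℤ.pos-* r (suc k ℕ.^ n) ⟨
    + (r ℕ.* suc k ℕ.^ n)    ≤⟨ +≤+ rkⁿ≤aⁿ ⟩
    + (a ℕ.^ n)              ≡⟨ ℤ.*-identityʳ (+ (a ℕ.^ n)) ⟨
    + (a ℕ.^ n) ℤ.* + 1      ≡⟨ cong (ℤ._* + 1) (↥-^ᵘ a k n) ⟨
    ↥ P ℤ.* + 1              ∎
    where open ℤ.≤-Reasoning

^ℚ-nonNeg : ∀ {p} → 0ℚ ≤ p → ∀ n → 0ℚ ≤ p ^ℚ n
^ℚ-nonNeg p≥0 zero    = ℚ.nonNegative⁻¹ 1ℚ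
^ℚ-nonNeg {p} p≥0 (suc n) = ℚ.nonNegative⁻¹ (p * p ^ℚ n)
  {{ℚ.nonNeg*nonNeg⇒nonNeg p {{nonNegative p≥0}} (p ^ℚ n) {{nonNegative (^ℚ-nonNeg p≥0 n)}}}}

^ℚ-monoˡ-≤ : ∀ {p q} → 0ℚ ≤ p → p ≤ q → ∀ n → p ^ℚ n ≤ q ^ℚ n
^ℚ-monoˡ-≤ p≥0 p≤q zero    = ℚ.≤-refl
^ℚ-monoˡ-≤ {p} {q} p≥0 p≤q (suc n) = ℚ.≤-trans
  (ℚ.*-monoˡ-≤-nonNeg p {{nonNegative p≥0}} (^ℚ-monoˡ-≤ p≥0 p≤q n))
  (ℚ.*-monoʳ-≤-nonNeg (q ^ℚ n) {{nonNegative (^ℚ-nonNeg (ℚ.≤-trans p≥0 p≤q) n)}} p≤q)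

-- The constant is c = q − 1/(2D): the margin over S/D = q − 1/D absorbs the
-- factor 3 once n > 4S, by Bernoulli's inequality.
corollary5p7 : (m : ℕ) →
    Σ[ c ∈ ℚ ] (c < (+ suc (suc m)) / 1) ×
      ((T : Tensor (Fin (suc (suc m))) (Fin (suc (suc m))) (Fin (suc (suc m)))) →
        T (fromℕ (suc m)) fz fz →
        T fz (fromℕ (suc m)) fz →
        (∀ j k → T (fromℕ (suc m)) j k → (j ≡ fz) × (k ≡ fz)) →
        (∀ i k → T i (fromℕ (suc m)) k → (i ≡ fz) × (k ≡ fz)) →
        (ε : ℚ) → 0ℚ < ε →
        Σ[ N ∈ ℕ ] ((n : ℕ) → n ≥ N → (r : ℕ) → IndepZeroOut (TensorPow T n) r →
          (+ r) / 1 ≤ (c + ε) ^ℚ n))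
corollary5p7 m = c , c<q , λ T _ _ x-last-isolated y-last-isolated ε ε>0 →
  suc (2 ℕ.* (2 ℕ.* S)) , λ n n>4S r Z → begin
    (+ r) / 1     ≤⟨ fromℕ≤fraction^ r (suc (2 ℕ.* S)) _ n
                       (absorb-three {r} {D} {S} {n} (corner-independent-bound T x-last-isolated y-last-isolated Z) n>4S) ⟩
    c ^ℚ n        ≤⟨ ^ℚ-monoˡ-≤ c≥0 (c≤c+ε ε>0) n ⟩
    (c + ε) ^ℚ n  ∎
  where
  open CornerWeights m
  open ℚ.≤-Reasoning
  c : ℚ
  c = (+ suc (2 ℕ.* S)) / (2 ℕ.* D)
  c<q : c < (+ q) / 1
  c<q = fraction<fraction (suc (2 ℕ.* S)) _ q 0 2S+1<2qD
  c≥0 : 0ℚ ≤ c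
  c≥0 = ℚ.nonNegative⁻¹ c {{ℚ.normalize-nonNeg (suc (2 ℕ.* S)) (2 ℕ.* D)}}
  c≤c+ε : ∀ {ε} → 0ℚ < ε → c ≤ c + ε
  c≤c+ε {ε} ε>0 = subst (_≤ c + ε) (ℚ.+-identityʳ c) (ℚ.+-monoʳ-≤ c (ℚ.<⇒≤ ε>0))
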